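{- Let $\Gamma$ be a finite connected, non-complete, locally cyclic graph. Then $\Gamma$ is $2$-geodesic transitive if and only if $\Gamma$ is isomorphic to $K_{3[2]}$ or to the icosahedron.
   Context: All graphs are finite, simple and undirected. A graph $\Gamma$ of valency $n$ is locally cyclic if for every vertex $u$ the subgraph induced on the set of neighbours of $u$ is isomorphic to the cycle $C_n$. $K_{3[2]}$ denotes the complete multipartite graph with $3$ parts of size $2$. A $1$-geodesic is an arc (ordered pair of adjacent vertices); a $2$-geodesic is a triple $(u,v,w)$ with $v$ adjacent to $u$ and $w$ and $d_\Gamma(u,w)=2$. $\Gamma$ is $2$-geodesic transitive if $\mathrm{Aut}(\Gamma)$ is transitive on the set of arcs and on the set of $2$-geodesics. -}

module Defs where

open import Data.Bool using (Bool; true; false; T; not; _∧_; _∨_)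
open import Data.Bool.Properties using (∨-comm)
open import Data.Nat using (ℕ; zero; suc; _≡ᵇ_; _<_; _≤_; _/_)
open import Data.Fin using (Fin; toℕ)
open import Data.List using (List; []; _∷_)
open import Data.Bool.ListAction using (any)
open import Data.Product using (Σ; _×_; _,_; proj₁; proj₂; ∃)
open import Function.Bundles using (_↔_; Inverse)
open import Relation.Nullary using (¬_)
open import Relation.Binary.PropositionalEquality using (_≡_; _≢_; refl; cong; cong₂)

record Graph : Set₁ where
  field
    V     : Set
    adj   : V → V → Bool
    sym   : ∀ x y → adj x y ≡ adj y x
    irrefl : ∀ x → adj x x ≡ false

open Graph public

Adj : (G : Graph) → V G → V G → Set
Adj G x y = T (adj G x y)

Finite : Graph → Set
Finite G = Σ ℕ (λ n → V G ↔ Fin n)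

data Walk (G : Graph) : V G → V G → ℕ → Set where
  []  : ∀ {x} → Walk G x x 0
  _∷_ : ∀ {x y z k} → Adj G x y → Walk G y z k → Walk G x z (suc k)

Connected : Graph → Set
Connected G = ∀ x y → Σ ℕ (λ k → Walk G x y k)

Dist : (G : Graph) → V G → V G → ℕ → Set
Dist G x y k = Walk G x y k × (∀ m → m < k → ¬ Walk G x y m)

NonComplete : Graph → Set
NonComplete G = Σ (V G) λ x → Σ (V G) λ y → x ≢ y × ¬ Adj G x y

record _≅_ (G H : Graph) : Set where
  field
    bij  : V G ↔ V H
    pres : ∀ x y → adj G x y ≡ adj H (Inverse.to bij x) (Inverse.to bij y)

open _≅_ public

Aut : Graph → Set
Aut G = G ≅ G

act : {G : Graph} → Aut G → V G → V G
act g = Inverse.to (bij g)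

Induced : (G : Graph) → (V G → Set) → Graph
Induced G P = record
  { V = Σ (V G) P
  ; adj = λ x y → adj G (proj₁ x) (proj₁ y)
  ; sym = λ x y → sym G (proj₁ x) (proj₁ y)
  ; irrefl = λ x → irrefl G (proj₁ x)
  }

Nbhd : (G : Graph) → V G → Graph
Nbhd G u = Induced G (Adj G u)

-- Graphs on Fin n from a "generating" edge predicate E: i ~ j iff
-- i ≠ j and (E i j or E j i).

≡ᵇ-refl : ∀ n → (n ≡ᵇ n) ≡ true
≡ᵇ-refl zero = refl
≡ᵇ-refl (suc n) = ≡ᵇ-refl n

≡ᵇ-sym : ∀ m n → (m ≡ᵇ n) ≡ (n ≡ᵇ m)
≡ᵇ-sym zero zero = refl
≡ᵇ-sym zero (suc n) = refl
≡ᵇ-sym (suc m) zero = refl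
≡ᵇ-sym (suc m) (suc n) = ≡ᵇ-sym m n

mkGraph : (n : ℕ) → (Fin n → Fin n → Bool) → Graph
mkGraph n E = record
  { V = Fin n
  ; adj = λ i j → not (toℕ i ≡ᵇ toℕ j) ∧ (E i j ∨ E j i)
  ; sym = λ i j → cong₂ (λ a b → not a ∧ b) (≡ᵇ-sym (toℕ i) (toℕ j)) (∨-comm (E i j) (E j i))
  ; irrefl = λ i → cong (λ a → not a ∧ (E i i ∨ E i i)) (≡ᵇ-refl (toℕ i))
  }

-- the cycle C_k on Fin k (meant for k ≥ 3): i ~ i+1 mod k
cycleSucc : (k : ℕ) → Fin k → Fin k → Bool
cycleSucc k i j = (toℕ j ≡ᵇ suc (toℕ i)) ∨ ((toℕ i ≡ᵇ Data.Nat._∸_ k 1) ∧ (toℕ j ≡ᵇ 0))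

C : ℕ → Graph
C k = mkGraph k (cycleSucc k)

LocallyCyclic : Graph → Set
LocallyCyclic G = Σ ℕ λ n → 3 ≤ n × (∀ u → Nbhd G u ≅ C n)

-- K_{3[2]} on Fin 6 with parts {0,1},{2,3},{4,5}
K3[2] : Graph
K3[2] = mkGraph 6 (λ i j → not ((toℕ i / 2) ≡ᵇ (toℕ j / 2)))

-- the icosahedron on Fin 12: apex 0, upper pentagon 1..5,
-- lower pentagon 6..10, apex 11
icosaEdges : List (ℕ × ℕ)
icosaEdges =
  (0 , 1) ∷ (0 , 2) ∷ (0 , 3) ∷ (0 , 4) ∷ (0 , 5) ∷
  (1 , 2) ∷ (2 , 3) ∷ (3 , 4) ∷ (4 , 5) ∷ (5 , 1) ∷
  (1 , 6) ∷ (1 , 7) ∷ (2 , 7) ∷ (2 , 8) ∷ (3 , 8) ∷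
  (3 , 9) ∷ (4 , 9) ∷ (4 , 10) ∷ (5 , 10) ∷ (5 , 6) ∷
  (6 , 7) ∷ (7 , 8) ∷ (8 , 9) ∷ (9 , 10) ∷ (10 , 6) ∷
  (11 , 6) ∷ (11 , 7) ∷ (11 , 8) ∷ (11 , 9) ∷ (11 , 10) ∷ []

Icosahedron : Graph
Icosahedron = mkGraph 12 (λ i j →
  any (λ e → (proj₁ e ≡ᵇ toℕ i) ∧ (proj₂ e ≡ᵇ toℕ j)) icosaEdges)

Arc : Graph → Set
Arc G = Σ (V G) λ u → Σ (V G) λ v → Adj G u v

TwoGeodesic : Graph → Set
TwoGeodesic G = Σ (V G) λ u → Σ (V G) λ v → Σ (V G) λ w →
  Adj G u v × Adj G v w × Dist G u w 2

ArcTransitive : Graph → Set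
ArcTransitive G = (a b : Arc G) → Σ (Aut G) λ g →
  act g (proj₁ a) ≡ proj₁ b × act g (proj₁ (proj₂ a)) ≡ proj₁ (proj₂ b)

TwoGeodesicTransitive' : Graph → Set
TwoGeodesicTransitive' G = (a b : TwoGeodesic G) → Σ (Aut G) λ g →
  act g (proj₁ a) ≡ proj₁ b ×
  act g (proj₁ (proj₂ a)) ≡ proj₁ (proj₂ b) ×
  act g (proj₁ (proj₂ (proj₂ a))) ≡ proj₁ (proj₂ (proj₂ b))

TwoGeodesicTransitive : Graph → Set
TwoGeodesicTransitive G = ArcTransitive G × TwoGeodesicTransitive' G

-- A connected non-complete graph contains a 2-geodesic (finiteness is only used to decide
-- equality of vertices), which rules out valency 3: the link C₃ is complete.  For valency
-- n ≥ 6 the 2-geodesics (u, v, w₂) and (u, v, w₃), where u, w₂, w₃ sit at positions 0, 2, 3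
-- of the link cycle of v, cannot be exchanged by an automorphism: u and w₂ have a common
-- neighbour in the link of v, u and w₃ do not.  For n = 4 and n = 5 a connected locally C_n
-- graph is rigid: starting from one triangle, each link is forced by the links already known,
-- and one obtains an isomorphism onto K_{3[2]} resp. the icosahedron sending that triangle to
-- a fixed one.  Conversely, this rigidity makes both graphs 2-geodesic transitive, since every
-- arc and every 2-geodesic extends to a triangle in a way that is unique up to the model.
module Submission where

open import Defs hiding (sym)
open import Data.Bool using (Bool; true; false; T; not; _∧_; if_then_else_)
open import Data.Bool.ListAction using (any)
open import Data.Bool.Properties as Bool using (T-irrelevant)
open import Data.Nat using (ℕ; zero; suc; _+_; _∸_; _≡ᵇ_; _/_; _≤_; _<_; s≤s; z≤n; NonZero)
open import Data.Nat.DivMod using (_mod_)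
open import Data.Fin using (Fin; toℕ; #_) renaming (zero to fz; suc to fs)
open import Data.Fin.Properties using (all?; any?; _≟_; inj⇒≟; cantor-schröder-bernstein)
open import Data.Product using (Σ; ∃; _×_; _,_; proj₁; proj₂)
open import Data.Sum using (_⊎_; inj₁; inj₂; [_,_])
open import Data.Empty using (⊥-elim)
open import Data.Unit using (tt)
open import Data.Vec using (Vec; []; _∷_; lookup; map; allFin)
open import Data.Vec.Properties using (lookup-map)
open import Data.Vec.Relation.Unary.All as All using (All; []; _∷_)
open import Data.Vec.Membership.Propositional.Properties using (∈-allFin⁺)
open import Function.Bundles using (Inverse; _⇔_; mk⇔; mk↔ₛ′)
open import Function.Properties.Inverse using (↔⇒↣; ↔-sym; ↔-trans)
open import Relation.Nullary using (¬_; Dec; yes; no)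
open import Relation.Nullary.Decidable
  using (True; False; toWitness; toWitnessFalse; from-yes; map′; _→-dec_; _×-dec_; _⊎-dec_; ¬?; T?)
open import Relation.Binary.Definitions using (DecidableEquality)
open import Relation.Binary.PropositionalEquality using (_≡_; _≢_; refl; sym; trans; cong; cong₂; subst)

adj-sym : (G : Graph) {x y : V G} → Adj G x y → Adj G y x
adj-sym G {x} {y} = subst T (Graph.sym G x y)

module _ {G H : Graph} (ψ : G ≅ H) where

  to : V G → V H
  to = Inverse.to (bij ψ)

  from : V H → V G
  from = Inverse.from (bij ψ)

  to-from : ∀ y → to (from y) ≡ y
  to-from = Inverse.strictlyInverseˡ (bij ψ)

  from-to : ∀ x → from (to x) ≡ x
  from-to = Inverse.strictlyInverseʳ (bij ψ)

  to-injective : ∀ {x y} → to x ≡ to y → x ≡ y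
  to-injective {x} {y} e = trans (sym (from-to x)) (trans (cong from e) (from-to y))

  from-injective : ∀ {x y} → from x ≡ from y → x ≡ y
  from-injective {x} {y} e = trans (sym (to-from x)) (trans (cong to e) (to-from y))

  to-adj : ∀ {x y} → Adj G x y → Adj H (to x) (to y)
  to-adj {x} {y} = subst T (pres ψ x y)

  pres-from : ∀ x y → adj H x y ≡ adj G (from x) (from y)
  pres-from x y = sym (trans (pres ψ (from x) (from y)) (cong₂ (adj H) (to-from x) (to-from y)))

  from-adj : ∀ {x y} → Adj H x y → Adj G (from x) (from y)
  from-adj {x} {y} = subst T (pres-from x y)

≅-sym : {G H : Graph} → G ≅ H → H ≅ G
≅-sym ψ = record { bij = ↔-sym (bij ψ) ; pres = pres-from ψ }

≅-trans : {G H K : Graph} → G ≅ H → H ≅ K → G ≅ K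
≅-trans ψ χ = record
  { bij  = ↔-trans (bij ψ) (bij χ)
  ; pres = λ x y → trans (pres ψ x y) (pres χ (to ψ x) (to ψ y))
  }

act-≅-trans-≅-sym : {G H : Graph} (ψ χ : G ≅ H) {x y : V G} →
                    to ψ x ≡ to χ y → act (≅-trans ψ (≅-sym χ)) x ≡ y
act-≅-trans-≅-sym ψ χ {y = y} e = trans (cong (from χ) e) (from-to χ y)

finite⇒≟ : (G : Graph) → Finite G → DecidableEquality (V G)
finite⇒≟ G (n , b) = inj⇒≟ (↔⇒↣ b)

module _ {G : Graph} where

  dist-2 : ∀ {u v w} → Adj G u v → Adj G v w → u ≢ w → ¬ Adj G u w → Dist G u w 2
  dist-2 {u} {v} {w} uv vw u≢w u≁w = (uv ∷ (vw ∷ [])) , shorter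
    where
    shorter : ∀ k → k < 2 → ¬ Walk G u w k
    shorter zero          _ []         = u≢w refl
    shorter (suc zero)    _ (uw ∷ [])  = u≁w uw
    shorter (suc (suc k)) (s≤s (s≤s ()))

  dist-2⇒≢ : ∀ {u w} → Dist G u w 2 → u ≢ w
  dist-2⇒≢ (_ , shorter) refl = shorter 0 (s≤s z≤n) []

  dist-2⇒≁ : ∀ {u w} → Dist G u w 2 → ¬ Adj G u w
  dist-2⇒≁ (_ , shorter) uw = shorter 1 (s≤s (s≤s z≤n)) (uw ∷ [])

  -- Generalised so that induction can run along the walk.
  near-or-2-geodesic : DecidableEquality (V G) → ∀ {b y k} → Walk G b y k →
                       ∀ a → a ≡ b ⊎ Adj G a b → a ≡ y ⊎ Adj G a y ⊎ TwoGeodesic G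
  near-or-2-geodesic _≟_ []  a (inj₁ a≡b) = inj₁ a≡b
  near-or-2-geodesic _≟_ []  a (inj₂ ab)  = inj₂ (inj₁ ab)
  near-or-2-geodesic _≟_ {b} (_∷_ {y = c} bc w) a near with a ≟ c | adj G a c in ac
  ... | yes refl | _     = near-or-2-geodesic _≟_ w a (inj₁ refl)
  ... | no _     | true  = near-or-2-geodesic _≟_ w a (inj₂ (subst T (sym ac) tt))
  ... | no a≢c   | false with near
  ...   | inj₁ refl = ⊥-elim (subst T ac bc)
  ...   | inj₂ ab   = inj₂ (inj₂ (a , b , c , ab , bc , dist-2 ab bc a≢c (subst T ac)))

  2-geodesic-exists : DecidableEquality (V G) → Connected G → NonComplete G → TwoGeodesic G
  2-geodesic-exists _≟_ conn (x , y , x≢y , x≁y)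
    with near-or-2-geodesic _≟_ (proj₂ (conn x y)) x (inj₁ refl)
  ... | inj₁ x≡y        = ⊥-elim (x≢y x≡y)
  ... | inj₂ (inj₁ xy)  = ⊥-elim (x≁y xy)
  ... | inj₂ (inj₂ geo) = geo

IsCycleSymmetry : (m : ℕ) → (Fin m → Fin m) → Set
IsCycleSymmetry m σ =
  (∀ k l → adj (C m) (σ k) (σ l) ≡ adj (C m) k l) × (∀ k l → σ k ≡ σ l → k ≡ l) × (∀ j → ∃ λ k → σ k ≡ j)

isCycleSymmetry? : ∀ m σ → Dec (IsCycleSymmetry m σ)
isCycleSymmetry? m σ =
  (all? λ k → all? λ l → adj (C m) (σ k) (σ l) Bool.≟ adj (C m) k l) ×-dec
  (all? λ k → all? λ l → σ k ≟ σ l →-dec k ≟ l) ×-dec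
  (all? λ j → any? λ k → σ k ≟ j)

-- For adjacent i, j the map sending 0 ↦ i and 1 ↦ j: k ↦ i + k if j = i + 1, and k ↦ i − k otherwise.
cycle-symmetry : (m : ℕ) .{{_ : NonZero m}} → Fin m → Fin m → Fin m → Fin m
cycle-symmetry m i j k =
  if toℕ j ≡ᵇ toℕ (suc (toℕ i) mod m) then (toℕ i + toℕ k) mod m else (toℕ i + (m ∸ toℕ k)) mod m

-- Stated for C (2 + n) so that the positions 0 and 1 exist.
record ShortCycle (n : ℕ) : Set where
  field
    cycle-symmetry-sends : ∀ i j → Adj (C (2 + n)) i j →
      IsCycleSymmetry (2 + n) (cycle-symmetry (2 + n) i j) ×
      cycle-symmetry (2 + n) i j fz ≡ i × cycle-symmetry (2 + n) i j (fs fz) ≡ j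
    ≤2-neighbours : ∀ i a b c → Adj (C (2 + n)) i a → Adj (C (2 + n)) i b → Adj (C (2 + n)) i c →
                    a ≢ c → b ≢ c → a ≡ b
    has-neighbour : ∀ i → ∃ λ j → Adj (C (2 + n)) i j
    diameter-2    : ∀ i j → i ≢ j → ¬ Adj (C (2 + n)) i j → ∃ λ k → Adj (C (2 + n)) i k × Adj (C (2 + n)) k j

shortCycle? : ∀ n → Dec (ShortCycle n)
shortCycle? n =
  map′ (λ (s , t , h , d) → record
          { cycle-symmetry-sends = s ; ≤2-neighbours = t ; has-neighbour = h ; diameter-2 = d })
       (λ S → let open ShortCycle S in cycle-symmetry-sends , ≤2-neighbours , has-neighbour , diameter-2)
       ((all? λ i → all? λ j → A? i j →-dec
           isCycleSymmetry? (2 + n) (σ i j) ×-dec σ i j fz ≟ i ×-dec σ i j (fs fz) ≟ j) ×-dec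
        (all? λ i → all? λ a → all? λ b → all? λ c →
           A? i a →-dec A? i b →-dec A? i c →-dec ¬? (a ≟ c) →-dec ¬? (b ≟ c) →-dec a ≟ b) ×-dec
        (all? λ i → any? λ j → A? i j) ×-dec
        (all? λ i → all? λ j → ¬? (i ≟ j) →-dec ¬? (A? i j) →-dec any? λ k → A? i k ×-dec A? k j))
  where
  σ : Fin (2 + n) → Fin (2 + n) → Fin (2 + n) → Fin (2 + n)
  σ = cycle-symmetry (2 + n)
  A? : ∀ i j → Dec (Adj (C (2 + n)) i j)
  A? i j = T? (adj (C (2 + n)) i j)

shortCycle : ∀ n → {_ : True (shortCycle? n)} → ShortCycle n
shortCycle n {ok} = toWitness ok

C4-short : ShortCycle 2
C4-short = shortCycle 2

C5-short : ShortCycle 3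
C5-short = shortCycle 3

record Chart (Γ : Graph) (m : ℕ) (x : V Γ) (z : Fin m → V Γ) : Set where
  field
    centre    : ∀ k → Adj Γ x (z k)
    rim       : ∀ k l → adj Γ (z k) (z l) ≡ adj (C m) k l
    injective : ∀ k l → z k ≡ z l → k ≡ l
    covers    : ∀ y → Adj Γ x y → ∃ λ k → z k ≡ y

  position : ∀ {y} → Adj Γ x y → Fin m
  position xy = proj₁ (covers _ xy)

  at-position : ∀ {y} (xy : Adj Γ x y) → z (position xy) ≡ y
  at-position xy = proj₂ (covers _ xy)

  position-≢ : ∀ {a b} (xa : Adj Γ x a) (xb : Adj Γ x b) → a ≢ b → position xa ≢ position xb
  position-≢ xa xb a≢b e = a≢b (trans (sym (at-position xa)) (trans (cong z e) (at-position xb)))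

  adj⇒rim : ∀ {k l a b} → z k ≡ a → z l ≡ b → Adj Γ a b → Adj (C m) k l
  adj⇒rim {k} {l} refl refl = subst T (rim k l)

  rim⇒adj : ∀ {k l a b} → z k ≡ a → z l ≡ b → Adj (C m) k l → Adj Γ a b
  rim⇒adj {k} {l} refl refl = subst T (sym (rim k l))

  rim-adj : ∀ k l → {T (adj (C m) k l)} → Adj Γ (z k) (z l)
  rim-adj k l {kl} = rim⇒adj refl refl kl

  distinct : ∀ k l → {False (k ≟ l)} → z k ≢ z l
  distinct k l {k≢l} e = toWitnessFalse k≢l (injective k l e)

open Chart public

module _ {Γ : Graph} {m : ℕ} where

  chart-cong : ∀ {x z z′} → (∀ k → z k ≡ z′ k) → Chart Γ m x z → Chart Γ m x z′
  chart-cong {x} z≗z′ c = record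
    { centre    = λ k → subst (Adj Γ x) (z≗z′ k) (centre c k)
    ; rim       = λ k l → trans (sym (cong₂ (adj Γ) (z≗z′ k) (z≗z′ l))) (rim c k l)
    ; injective = λ k l e → injective c k l (trans (z≗z′ k) (trans e (sym (z≗z′ l))))
    ; covers    = λ y xy → let k , zk≡y = covers c y xy in k , trans (sym (z≗z′ k)) zk≡y
    }

  chart-∘ : ∀ {x z σ} → Chart Γ m x z → IsCycleSymmetry m σ → Chart Γ m x (λ k → z (σ k))
  chart-∘ {z = z} {σ} c (σ-rim , σ-injective , σ-surjective) = record
    { centre    = λ k → centre c (σ k)
    ; rim       = λ k l → trans (rim c (σ k) (σ l)) (σ-rim k l)
    ; injective = λ k l e → σ-injective k l (injective c (σ k) (σ l) e)
    ; covers    = λ y xy → let k , zk≡y = covers c y xy ; j , σj≡k = σ-surjective k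
                           in j , trans (cong z σj≡k) zk≡y
    }

  link : (∀ u → Nbhd Γ u ≅ C m) → V Γ → Fin m → V Γ
  link L x k = proj₁ (from (L x) k)

  link-chart : (L : ∀ u → Nbhd Γ u ≅ C m) → ∀ x → Chart Γ m x (link L x)
  link-chart L x = record
    { centre    = λ k → proj₂ (from (L x) k)
    ; rim       = λ k l → sym (pres-from (L x) k l)
    ; injective = λ k l e → from-injective (L x) (Σ-≡ e)
    ; covers    = λ y xy → to (L x) (y , xy) , cong proj₁ (from-to (L x) (y , xy))
    }
    where
    Σ-≡ : ∀ {a b : Σ (V Γ) (Adj Γ x)} → proj₁ a ≡ proj₁ b → a ≡ b
    Σ-≡ {y , p} {.y , q} refl = cong (y ,_) (T-irrelevant p q)

record Wheel (Γ : Graph) (n : ℕ) (x y₀ y₁ : V Γ) : Set where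
  field
    spoke   : Fin (2 + n) → V Γ
    chart   : Chart Γ (2 + n) x spoke
    spoke-0 : spoke fz ≡ y₀
    spoke-1 : spoke (fs fz) ≡ y₁

open Wheel public

flanks? : ∀ m (k l j : Fin m) → Dec (Adj (C m) k l × Adj (C m) k j × l ≢ j)
flanks? m k l j = T? (adj (C m) k l) ×-dec T? (adj (C m) k j) ×-dec ¬? (l ≟ j)

module Wheels {n : ℕ} (S : ShortCycle n) {Γ : Graph} (L : ∀ u → Nbhd Γ u ≅ C (2 + n)) where
  open ShortCycle S

  wheel : ∀ {x y₀ y₁} → Adj Γ x y₀ → Adj Γ x y₁ → Adj Γ y₀ y₁ → Wheel Γ n x y₀ y₁
  wheel {x} xy₀ xy₁ y₀y₁ =
    rotate (cycle-symmetry-sends i j (adj⇒rim c (at-position c xy₀) (at-position c xy₁) y₀y₁))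
    where
    c : Chart Γ (2 + n) x (link L x)
    c = link-chart L x
    i j : Fin (2 + n)
    i = position c xy₀
    j = position c xy₁
    σ : Fin (2 + n) → Fin (2 + n)
    σ = cycle-symmetry (2 + n) i j
    rotate : IsCycleSymmetry (2 + n) σ × σ fz ≡ i × σ (fs fz) ≡ j → Wheel Γ n x _ _
    rotate (σ-symmetry , σ0≡i , σ1≡j) = record
      { spoke   = λ k → link L x (σ k)
      ; chart   = chart-∘ c σ-symmetry
      ; spoke-0 = trans (cong (link L x) σ0≡i) (at-position c xy₀)
      ; spoke-1 = trans (cong (link L x) σ1≡j) (at-position c xy₁)
      }

  chart-pin : ∀ {x z} → Chart Γ (2 + n) x z → ∀ {k l j a b p} → z k ≡ a → z l ≡ b →
              {_ : True (flanks? (2 + n) k l j)} → Adj Γ x p → Adj Γ a p → p ≢ b → z j ≡ p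
  chart-pin {z = z} c {k} {l} {j} {p = p} zk≡a zl≡b {k-flanks} xp ap p≢b = pinned (toWitness k-flanks)
    where
    i : Fin (2 + n)
    i = position c xp
    pinned : Adj (C (2 + n)) k l × Adj (C (2 + n)) k j × l ≢ j → z j ≡ p
    pinned (kl , kj , l≢j) = trans (cong z (sym i≡j)) (at-position c xp)
      where
      i≡j : i ≡ j
      i≡j = ≤2-neighbours k i j l (adj⇒rim c zk≡a (at-position c xp) ap) kj kl
              (λ i≡l → p≢b (trans (sym (at-position c xp)) (trans (cong z i≡l) zl≡b))) (λ j≡l → l≢j (sym j≡l))

chart? : ∀ {N m} (E : Fin N → Fin N → Bool) i z → Dec (Chart (mkGraph N E) m i z)
chart? {N} {m} E i z =
  map′ (λ (c , r , inj , cov) → record { centre = c ; rim = r ; injective = inj ; covers = cov })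
       (λ c → centre c , rim c , injective c , covers c)
       ((all? λ k → T? (adj H i (z k))) ×-dec
        (all? λ k → all? λ l → adj H (z k) (z l) Bool.≟ adj (C m) k l) ×-dec
        (all? λ k → all? λ l → z k ≟ z l →-dec k ≟ l) ×-dec
        (all? λ y → T? (adj H i y) →-dec any? λ k → z k ≟ y))
  where
  H : Graph
  H = mkGraph N E

¬T-≡ : ∀ {a b} → ¬ T a → ¬ T b → a ≡ b
¬T-≡ {false} {false} _  _  = refl
¬T-≡ {true}          ¬a _  = ⊥-elim (¬a tt)
¬T-≡ {_}     {true}  _  ¬b = ⊥-elim (¬b tt)

-- A map φ from the model into Γ whose charts follow the rows is an isomorphism once every pair
-- i, j is Together (both lie in one row, so the chart of that row decides adjacency and
-- equality of φ i, φ j) or Apart: then φ i ~ φ j would make φ j some φ (row i l), and φ i = φ j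
-- would make φ (row j p) some φ (row i l), both excluded because Separated pairs have
-- distinct images.
module Model {N m : ℕ} (E : Fin N → Fin N → Bool) (rows : Vec (Vec (Fin N) m) N) where

  H : Graph
  H = mkGraph N E

  row : Fin N → Fin m → Fin N
  row i = lookup (lookup rows i)

  Together : Fin N → Fin N → Set
  Together i j = ∃ λ t → (∃ λ k → row t k ≡ i) × (∃ λ l → row t l ≡ j)

  together? : ∀ i j → Dec (Together i j)
  together? i j = any? λ t → (any? λ k → row t k ≟ i) ×-dec (any? λ l → row t l ≟ j)

  Separated : Fin N → Fin N → Set
  Separated a b = (Together a b × a ≢ b) ⊎ ∃ λ c → Adj H c a × ¬ Adj H c b × Together c a × Together c b

  separated? : ∀ a b → Dec (Separated a b)
  separated? a b = (together? a b ×-dec ¬? (a ≟ b)) ⊎-dec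
    any? λ c → T? (adj H c a) ×-dec ¬? (T? (adj H c b)) ×-dec together? c a ×-dec together? c b

  Apart : Fin N → Fin N → Set
  Apart i j = ¬ Adj H i j × (∀ l → Separated j (row i l)) × ∃ λ p → ∀ l → Separated (row j p) (row i l)

  apart? : ∀ i j → Dec (Apart i j)
  apart? i j = ¬? (T? (adj H i j)) ×-dec (all? λ l → separated? j (row i l)) ×-dec
    any? λ p → all? λ l → separated? (row j p) (row i l)

  Certificate : Set
  Certificate = (∀ i → Chart H m i (row i)) × (∀ i j → Together i j ⊎ Apart i j)

  certificate? : Dec Certificate
  certificate? = (all? λ i → chart? E i (row i)) ×-dec (all? λ i → all? λ j → together? i j ⊎-dec apart? i j)

  -- The charts are indexed through allFin and map so that, for concrete tables, they can be
  -- supplied as a literal list.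
  module FromCharts {Γ : Graph} (conn : Connected Γ) (φs : Vec (V Γ) N)
           (charts : All (λ i → Chart Γ m (lookup φs i) (lookup (map (lookup φs) (lookup rows i)))) (allFin N))
           (root : Fin N) (certificate : Certificate) where

    φ : Fin N → V Γ
    φ = lookup φs

    chart-at : ∀ i → Chart Γ m (φ i) (λ k → φ (row i k))
    chart-at i = chart-cong (λ k → lookup-map k φ (lookup rows i)) (All.lookup charts (∈-allFin⁺ i))

    model-chart : ∀ i → Chart H m i (row i)
    model-chart = proj₁ certificate

    together-or-apart : ∀ i j → Together i j ⊎ Apart i j
    together-or-apart = proj₂ certificate

    Faithful : Fin N → Fin N → Set
    Faithful i j = (adj Γ (φ i) (φ j) ≡ adj H i j) × (φ i ≡ φ j → i ≡ j)

    together-faithful : ∀ {i j} → Together i j → Faithful i j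
    together-faithful (t , (k , refl) , (l , refl)) =
      trans (rim (chart-at t) k l) (sym (rim (model-chart t) k l)) ,
      λ e → cong (row t) (injective (chart-at t) k l e)

    separated⇒≢ : ∀ {a b} → Separated a b → φ a ≢ φ b
    separated⇒≢ (inj₁ (a~b , a≢b)) e = a≢b (proj₂ (together-faithful a~b) e)
    separated⇒≢ (inj₂ (c , ca , ¬cb , c~a , c~b)) e = ¬cb
      (subst T (proj₁ (together-faithful c~b))
        (subst (Adj Γ (φ c)) e (subst T (sym (proj₁ (together-faithful c~a))) ca)))

    apart-faithful : ∀ {i j} → Apart i j → Faithful i j
    apart-faithful {i} {j} (i≁j , j-separated , p , far) = ¬T-≡ φi≁φj i≁j , φi≡φj⇒i≡j
      where
      φi≁φj : ¬ Adj Γ (φ i) (φ j)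
      φi≁φj ij = separated⇒≢ (j-separated (position (chart-at i) ij)) (sym (at-position (chart-at i) ij))
      φi≡φj⇒i≡j : φ i ≡ φ j → i ≡ j
      φi≡φj⇒i≡j e = ⊥-elim (separated⇒≢ (far (position (chart-at i) ij)) (sym (at-position (chart-at i) ij)))
        where
        ij : Adj Γ (φ i) (φ (row j p))
        ij = subst (λ x → Adj Γ x (φ (row j p))) (sym e) (centre (chart-at j) p)

    faithful : ∀ i j → Faithful i j
    faithful i j with together-or-apart i j
    ... | inj₁ i~j = together-faithful i~j
    ... | inj₂ i⋯j = apart-faithful i⋯j

    reach : ∀ {x y k} → Walk Γ x y k → ∃ (λ i → φ i ≡ x) → ∃ (λ i → φ i ≡ y)
    reach []           hit        = hit
    reach (xx′ ∷ walk) (i , refl) =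
      reach walk (row i (position (chart-at i) xx′) , at-position (chart-at i) xx′)

    index : V Γ → Fin N
    index y = proj₁ (reach (proj₂ (conn (φ root) y)) (root , refl))

    φ-index : ∀ y → φ (index y) ≡ y
    φ-index y = proj₂ (reach (proj₂ (conn (φ root) y)) (root , refl))

    index-φ : ∀ i → index (φ i) ≡ i
    index-φ i = proj₂ (faithful (index (φ i)) i) (φ-index (φ i))

    ≅-model : Γ ≅ H
    ≅-model = record
      { bij  = mk↔ₛ′ index φ index-φ φ-index
      ; pres = λ x y → trans (sym (cong₂ (adj Γ) (φ-index x) (φ-index y)))
                             (proj₁ (faithful (index x) (index y)))
      }

-- Defs.K3[2] and Defs.Icosahedron are mkGraph applied to these edge predicates.
K3[2]-edges : Fin 6 → Fin 6 → Bool
K3[2]-edges i j = not ((toℕ i / 2) ≡ᵇ (toℕ j / 2))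

icosahedron-edges : Fin 12 → Fin 12 → Bool
icosahedron-edges i j = any (λ e → (proj₁ e ≡ᵇ toℕ i) ∧ (proj₂ e ≡ᵇ toℕ j)) icosaEdges

-- Row i lists the neighbours of vertex i in cyclic order.
K3[2]-rows : Vec (Vec (Fin 6) 4) 6
K3[2]-rows =
  (# 2 ∷ # 4 ∷ # 3 ∷ # 5 ∷ []) ∷
  (# 2 ∷ # 4 ∷ # 3 ∷ # 5 ∷ []) ∷
  (# 0 ∷ # 4 ∷ # 1 ∷ # 5 ∷ []) ∷
  (# 4 ∷ # 0 ∷ # 5 ∷ # 1 ∷ []) ∷
  (# 0 ∷ # 2 ∷ # 1 ∷ # 3 ∷ []) ∷
  (# 0 ∷ # 2 ∷ # 1 ∷ # 3 ∷ []) ∷ []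

icosahedron-rows : Vec (Vec (Fin 12) 5) 12
icosahedron-rows =
  (# 1 ∷ # 2 ∷ # 3 ∷ # 4 ∷ # 5 ∷ []) ∷
  (# 0 ∷ # 2 ∷ # 7 ∷ # 6 ∷ # 5 ∷ []) ∷
  (# 1 ∷ # 0 ∷ # 3 ∷ # 8 ∷ # 7 ∷ []) ∷
  (# 2 ∷ # 0 ∷ # 4 ∷ # 9 ∷ # 8 ∷ []) ∷
  (# 3 ∷ # 0 ∷ # 5 ∷ # 10 ∷ # 9 ∷ []) ∷
  (# 4 ∷ # 0 ∷ # 1 ∷ # 6 ∷ # 10 ∷ []) ∷
  (# 5 ∷ # 1 ∷ # 7 ∷ # 11 ∷ # 10 ∷ []) ∷
  (# 2 ∷ # 1 ∷ # 6 ∷ # 11 ∷ # 8 ∷ []) ∷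
  (# 3 ∷ # 2 ∷ # 7 ∷ # 11 ∷ # 9 ∷ []) ∷
  (# 4 ∷ # 3 ∷ # 8 ∷ # 11 ∷ # 10 ∷ []) ∷
  (# 5 ∷ # 4 ∷ # 9 ∷ # 11 ∷ # 6 ∷ []) ∷
  (# 6 ∷ # 7 ∷ # 8 ∷ # 9 ∷ # 10 ∷ []) ∷ []

K3[2]-certificate : Model.Certificate K3[2]-edges K3[2]-rows
K3[2]-certificate = from-yes (Model.certificate? K3[2]-edges K3[2]-rows)

icosahedron-certificate : Model.Certificate icosahedron-edges icosahedron-rows
icosahedron-certificate = from-yes (Model.certificate? icosahedron-edges icosahedron-rows)

module K3[2]-Recognition {Γ : Graph} (L : ∀ u → Nbhd Γ u ≅ C 4) (conn : Connected Γ)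
                         {a b c : V Γ} (ab : Adj Γ a b) (ac : Adj Γ a c) (bc : Adj Γ b c) where
  open Wheels C4-short L

  chart4 : ∀ {x y₀ y₁ y₂ y₃} (w : Wheel Γ 2 x y₀ y₁) → spoke w (# 2) ≡ y₂ → spoke w (# 3) ≡ y₃ →
           Chart Γ 4 x (lookup (y₀ ∷ y₁ ∷ y₂ ∷ y₃ ∷ []))
  chart4 w e₂ e₃ = chart-cong
    (λ { fz → spoke-0 w ; (fs fz) → spoke-1 w ; (fs (fs fz)) → e₂ ; (fs (fs (fs fz))) → e₃ })
    (chart w)

  -- p i will correspond to model vertex i, and the chart of p i follows row i.  A wheel fixes
  -- the first two spokes; chart-pin identifies the others with vertices found earlier.
  p0 p2 p4 : V Γ
  p0 = a
  p2 = b
  p4 = c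
  W0 : Wheel Γ 2 p0 p2 p4
  W0 = wheel ab ac bc
  p3 p5 : V Γ
  p3 = spoke W0 (# 2)
  p5 = spoke W0 (# 3)
  L0 : Chart Γ 4 p0 (lookup (p2 ∷ p4 ∷ p3 ∷ p5 ∷ []))
  L0 = chart4 W0 refl refl

  W2 : Wheel Γ 2 p2 p0 p4
  W2 = wheel (adj-sym Γ ab) bc ac
  p1 : V Γ
  p1 = spoke W2 (# 2)
  L2 : Chart Γ 4 p2 (lookup (p0 ∷ p4 ∷ p1 ∷ p5 ∷ []))
  L2 = chart4 W2 refl
    (chart-pin (chart W2) (spoke-0 W2) (spoke-1 W2)
               (rim-adj L0 (# 0) (# 3)) (centre L0 (# 3)) (distinct L0 (# 3) (# 1)))

  W4 : Wheel Γ 2 p4 p0 p2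
  W4 = wheel (adj-sym Γ ac) (adj-sym Γ bc) ab
  L4 : Chart Γ 4 p4 (lookup (p0 ∷ p2 ∷ p1 ∷ p3 ∷ []))
  L4 = chart4 W4
    (chart-pin (chart W4) (spoke-1 W4) (spoke-0 W4)
               (rim-adj L2 (# 1) (# 2)) (centre L2 (# 2)) (distinct L2 (# 2) (# 0)))
    (chart-pin (chart W4) (spoke-0 W4) (spoke-1 W4)
               (rim-adj L0 (# 1) (# 2)) (centre L0 (# 2)) (distinct L0 (# 2) (# 0)))

  W3 : Wheel Γ 2 p3 p4 p0
  W3 = wheel (rim-adj L0 (# 2) (# 1)) (adj-sym Γ (centre L0 (# 2))) (adj-sym Γ ac)
  L3 : Chart Γ 4 p3 (lookup (p4 ∷ p0 ∷ p5 ∷ p1 ∷ []))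
  L3 = chart4 W3
    (chart-pin (chart W3) (spoke-1 W3) (spoke-0 W3)
               (rim-adj L0 (# 2) (# 3)) (centre L0 (# 3)) (distinct L0 (# 3) (# 1)))
    (chart-pin (chart W3) (spoke-0 W3) (spoke-1 W3)
               (rim-adj L4 (# 3) (# 2)) (centre L4 (# 2)) (distinct L4 (# 2) (# 0)))

  W5 : Wheel Γ 2 p5 p0 p2
  W5 = wheel (adj-sym Γ (centre L0 (# 3))) (rim-adj L0 (# 3) (# 0)) ab
  L5 : Chart Γ 4 p5 (lookup (p0 ∷ p2 ∷ p1 ∷ p3 ∷ []))
  L5 = chart4 W5
    (chart-pin (chart W5) (spoke-1 W5) (spoke-0 W5)
               (rim-adj L2 (# 3) (# 2)) (centre L2 (# 2)) (distinct L2 (# 2) (# 0)))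
    (chart-pin (chart W5) (spoke-0 W5) (spoke-1 W5)
               (rim-adj L0 (# 3) (# 2)) (centre L0 (# 2)) (distinct L0 (# 2) (# 0)))

  W1 : Wheel Γ 2 p1 p2 p4
  W1 = wheel (adj-sym Γ (centre L2 (# 2))) (rim-adj L2 (# 2) (# 1)) bc
  L1 : Chart Γ 4 p1 (lookup (p2 ∷ p4 ∷ p3 ∷ p5 ∷ []))
  L1 = chart4 W1
    (chart-pin (chart W1) (spoke-1 W1) (spoke-0 W1)
               (rim-adj L4 (# 2) (# 3)) (centre L4 (# 3)) (distinct L0 (# 2) (# 0)))
    (chart-pin (chart W1) (spoke-0 W1) (spoke-1 W1)
               (rim-adj L2 (# 2) (# 3)) (centre L2 (# 3)) (distinct L0 (# 3) (# 1)))

  open Model K3[2]-edges K3[2]-rows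
  open FromCharts conn (p0 ∷ p1 ∷ p2 ∷ p3 ∷ p4 ∷ p5 ∷ [])
                     (L0 ∷ L1 ∷ L2 ∷ L3 ∷ L4 ∷ L5 ∷ []) (# 0) K3[2]-certificate
    public using (≅-model; index-φ)

K3[2]-recognition : {Γ : Graph} → (∀ u → Nbhd Γ u ≅ C 4) → Connected Γ →
                    ∀ {a b c} → Adj Γ a b → Adj Γ a c → Adj Γ b c →
                    Σ (Γ ≅ K3[2]) λ ψ → to ψ a ≡ # 0 × to ψ b ≡ # 2 × to ψ c ≡ # 4
K3[2]-recognition L conn ab ac bc = ≅-model , index-φ (# 0) , index-φ (# 2) , index-φ (# 4)
  where open K3[2]-Recognition L conn ab ac bc

module Icosahedron-Recognition {Γ : Graph} (L : ∀ u → Nbhd Γ u ≅ C 5) (conn : Connected Γ)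
                               {a b c : V Γ} (ab : Adj Γ a b) (ac : Adj Γ a c) (bc : Adj Γ b c) where
  open Wheels C5-short L

  chart5 : ∀ {x y₀ y₁ y₂ y₃ y₄} (w : Wheel Γ 3 x y₀ y₁) →
           spoke w (# 2) ≡ y₂ → spoke w (# 3) ≡ y₃ → spoke w (# 4) ≡ y₄ →
           Chart Γ 5 x (lookup (y₀ ∷ y₁ ∷ y₂ ∷ y₃ ∷ y₄ ∷ []))
  chart5 w e₂ e₃ e₄ = chart-cong
    (λ { fz → spoke-0 w ; (fs fz) → spoke-1 w ; (fs (fs fz)) → e₂ ; (fs (fs (fs fz))) → e₃
       ; (fs (fs (fs (fs fz)))) → e₄ })
    (chart w)

  p0 p1 p2 : V Γ
  p0 = a
  p1 = b
  p2 = c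
  W0 : Wheel Γ 3 p0 p1 p2
  W0 = wheel ab ac bc
  p3 p4 p5 : V Γ
  p3 = spoke W0 (# 2)
  p4 = spoke W0 (# 3)
  p5 = spoke W0 (# 4)
  L0 : Chart Γ 5 p0 (lookup (p1 ∷ p2 ∷ p3 ∷ p4 ∷ p5 ∷ []))
  L0 = chart5 W0 refl refl refl

  W1 : Wheel Γ 3 p1 p0 p2
  W1 = wheel (adj-sym Γ ab) bc ac
  p7 p6 : V Γ
  p7 = spoke W1 (# 2)
  p6 = spoke W1 (# 3)
  L1 : Chart Γ 5 p1 (lookup (p0 ∷ p2 ∷ p7 ∷ p6 ∷ p5 ∷ []))
  L1 = chart5 W1 refl refl
    (chart-pin (chart W1) (spoke-0 W1) (spoke-1 W1)
               (rim-adj L0 (# 0) (# 4)) (centre L0 (# 4)) (distinct L0 (# 4) (# 1)))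

  W2 : Wheel Γ 3 p2 p1 p0
  W2 = wheel (adj-sym Γ bc) (adj-sym Γ ac) (adj-sym Γ ab)
  p8 : V Γ
  p8 = spoke W2 (# 3)
  L2 : Chart Γ 5 p2 (lookup (p1 ∷ p0 ∷ p3 ∷ p8 ∷ p7 ∷ []))
  L2 = chart5 W2
    (chart-pin (chart W2) (spoke-1 W2) (spoke-0 W2)
               (rim-adj L0 (# 1) (# 2)) (centre L0 (# 2)) (distinct L0 (# 2) (# 0)))
    refl
    (chart-pin (chart W2) (spoke-0 W2) (spoke-1 W2)
               (rim-adj L1 (# 1) (# 2)) (centre L1 (# 2)) (distinct L1 (# 2) (# 0)))

  W3 : Wheel Γ 3 p3 p2 p0
  W3 = wheel (rim-adj L0 (# 2) (# 1)) (adj-sym Γ (centre L0 (# 2))) (adj-sym Γ ac)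
  p9 : V Γ
  p9 = spoke W3 (# 3)
  L3 : Chart Γ 5 p3 (lookup (p2 ∷ p0 ∷ p4 ∷ p9 ∷ p8 ∷ []))
  L3 = chart5 W3
    (chart-pin (chart W3) (spoke-1 W3) (spoke-0 W3)
               (rim-adj L0 (# 2) (# 3)) (centre L0 (# 3)) (distinct L0 (# 3) (# 1)))
    refl
    (chart-pin (chart W3) (spoke-0 W3) (spoke-1 W3)
               (rim-adj L2 (# 2) (# 3)) (centre L2 (# 3)) (distinct L2 (# 3) (# 1)))

  W4 : Wheel Γ 3 p4 p3 p0
  W4 = wheel (rim-adj L0 (# 3) (# 2)) (adj-sym Γ (centre L0 (# 3))) (adj-sym Γ (centre L0 (# 2)))
  p10 : V Γ
  p10 = spoke W4 (# 3)
  L4 : Chart Γ 5 p4 (lookup (p3 ∷ p0 ∷ p5 ∷ p10 ∷ p9 ∷ []))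
  L4 = chart5 W4
    (chart-pin (chart W4) (spoke-1 W4) (spoke-0 W4)
               (rim-adj L0 (# 3) (# 4)) (centre L0 (# 4)) (distinct L0 (# 4) (# 2)))
    refl
    (chart-pin (chart W4) (spoke-0 W4) (spoke-1 W4)
               (rim-adj L3 (# 2) (# 3)) (centre L3 (# 3)) (distinct L3 (# 3) (# 1)))

  W5 : Wheel Γ 3 p5 p4 p0
  W5 = wheel (rim-adj L0 (# 4) (# 3)) (adj-sym Γ (centre L0 (# 4))) (adj-sym Γ (centre L0 (# 3)))
  q5 : spoke W5 (# 2) ≡ p1
  q5 = chart-pin (chart W5) (spoke-1 W5) (spoke-0 W5)
                 (rim-adj L0 (# 4) (# 0)) (centre L0 (# 0)) (distinct L0 (# 0) (# 3))
  L5 : Chart Γ 5 p5 (lookup (p4 ∷ p0 ∷ p1 ∷ p6 ∷ p10 ∷ []))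
  L5 = chart5 W5 q5
    (chart-pin (chart W5) q5 (spoke-1 W5)
               (rim-adj L1 (# 4) (# 3)) (centre L1 (# 3)) (distinct L1 (# 3) (# 0)))
    (chart-pin (chart W5) (spoke-0 W5) (spoke-1 W5)
               (rim-adj L4 (# 2) (# 3)) (centre L4 (# 3)) (distinct L4 (# 3) (# 1)))

  W6 : Wheel Γ 3 p6 p5 p1
  W6 = wheel (rim-adj L1 (# 3) (# 4)) (adj-sym Γ (centre L1 (# 3))) (rim-adj L0 (# 4) (# 0))
  p11 : V Γ
  p11 = spoke W6 (# 3)
  L6 : Chart Γ 5 p6 (lookup (p5 ∷ p1 ∷ p7 ∷ p11 ∷ p10 ∷ []))
  L6 = chart5 W6
    (chart-pin (chart W6) (spoke-1 W6) (spoke-0 W6)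
               (rim-adj L1 (# 3) (# 2)) (centre L1 (# 2)) (distinct L1 (# 2) (# 4)))
    refl
    (chart-pin (chart W6) (spoke-0 W6) (spoke-1 W6)
               (rim-adj L5 (# 3) (# 4)) (centre L5 (# 4)) (distinct L5 (# 4) (# 2)))

  W7 : Wheel Γ 3 p7 p2 p1
  W7 = wheel (rim-adj L1 (# 2) (# 1)) (adj-sym Γ (centre L1 (# 2))) (adj-sym Γ bc)
  q7 : spoke W7 (# 2) ≡ p6
  q7 = chart-pin (chart W7) (spoke-1 W7) (spoke-0 W7)
                 (rim-adj L1 (# 2) (# 3)) (centre L1 (# 3)) (distinct L1 (# 3) (# 1))
  L7 : Chart Γ 5 p7 (lookup (p2 ∷ p1 ∷ p6 ∷ p11 ∷ p8 ∷ []))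
  L7 = chart5 W7 q7
    (chart-pin (chart W7) q7 (spoke-1 W7)
               (rim-adj L6 (# 2) (# 3)) (centre L6 (# 3)) (distinct L6 (# 3) (# 1)))
    (chart-pin (chart W7) (spoke-0 W7) (spoke-1 W7)
               (rim-adj L2 (# 4) (# 3)) (centre L2 (# 3)) (distinct L2 (# 3) (# 0)))

  W8 : Wheel Γ 3 p8 p3 p2
  W8 = wheel (rim-adj L2 (# 3) (# 2)) (adj-sym Γ (centre L2 (# 3))) (adj-sym Γ (centre L2 (# 2)))
  q8 : spoke W8 (# 2) ≡ p7
  q8 = chart-pin (chart W8) (spoke-1 W8) (spoke-0 W8)
                 (rim-adj L2 (# 3) (# 4)) (centre L2 (# 4)) (distinct L2 (# 4) (# 2))
  L8 : Chart Γ 5 p8 (lookup (p3 ∷ p2 ∷ p7 ∷ p11 ∷ p9 ∷ []))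
  L8 = chart5 W8 q8
    (chart-pin (chart W8) q8 (spoke-1 W8)
               (rim-adj L7 (# 4) (# 3)) (centre L7 (# 3)) (distinct L7 (# 3) (# 0)))
    (chart-pin (chart W8) (spoke-0 W8) (spoke-1 W8)
               (rim-adj L3 (# 4) (# 3)) (centre L3 (# 3)) (distinct L3 (# 3) (# 0)))

  W9 : Wheel Γ 3 p9 p4 p3
  W9 = wheel (rim-adj L3 (# 3) (# 2)) (adj-sym Γ (centre L3 (# 3))) (adj-sym Γ (centre L3 (# 2)))
  q9 : spoke W9 (# 2) ≡ p8
  q9 = chart-pin (chart W9) (spoke-1 W9) (spoke-0 W9)
                 (rim-adj L3 (# 3) (# 4)) (centre L3 (# 4)) (distinct L3 (# 4) (# 2))
  L9 : Chart Γ 5 p9 (lookup (p4 ∷ p3 ∷ p8 ∷ p11 ∷ p10 ∷ []))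
  L9 = chart5 W9 q9
    (chart-pin (chart W9) q9 (spoke-1 W9)
               (rim-adj L8 (# 4) (# 3)) (centre L8 (# 3)) (distinct L8 (# 3) (# 0)))
    (chart-pin (chart W9) (spoke-0 W9) (spoke-1 W9)
               (rim-adj L4 (# 4) (# 3)) (centre L4 (# 3)) (distinct L4 (# 3) (# 0)))

  W10 : Wheel Γ 3 p10 p5 p4
  W10 = wheel (rim-adj L4 (# 3) (# 2)) (adj-sym Γ (centre L4 (# 3))) (adj-sym Γ (centre L4 (# 2)))
  q10 : spoke W10 (# 2) ≡ p9
  q10 = chart-pin (chart W10) (spoke-1 W10) (spoke-0 W10)
                  (rim-adj L4 (# 3) (# 4)) (centre L4 (# 4)) (distinct L4 (# 4) (# 2))
  L10 : Chart Γ 5 p10 (lookup (p5 ∷ p4 ∷ p9 ∷ p11 ∷ p6 ∷ []))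
  L10 = chart5 W10 q10
    (chart-pin (chart W10) q10 (spoke-1 W10)
               (rim-adj L9 (# 4) (# 3)) (centre L9 (# 3)) (distinct L9 (# 3) (# 0)))
    (chart-pin (chart W10) (spoke-0 W10) (spoke-1 W10)
               (rim-adj L5 (# 4) (# 3)) (centre L5 (# 3)) (distinct L5 (# 3) (# 0)))

  W11 : Wheel Γ 3 p11 p6 p7
  W11 = wheel (adj-sym Γ (centre L6 (# 3))) (adj-sym Γ (centre L7 (# 3))) (centre L6 (# 2))
  q11a : spoke W11 (# 2) ≡ p8
  q11a = chart-pin (chart W11) (spoke-1 W11) (spoke-0 W11)
                   (adj-sym Γ (centre L8 (# 3))) (centre L7 (# 4)) (distinct L7 (# 4) (# 2))
  q11b : spoke W11 (# 3) ≡ p9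
  q11b = chart-pin (chart W11) q11a (spoke-1 W11)
                   (adj-sym Γ (centre L9 (# 3))) (centre L8 (# 4)) (distinct L8 (# 4) (# 2))
  L11 : Chart Γ 5 p11 (lookup (p6 ∷ p7 ∷ p8 ∷ p9 ∷ p10 ∷ []))
  L11 = chart5 W11 q11a q11b
    (chart-pin (chart W11) q11b q11a
               (adj-sym Γ (centre L10 (# 3))) (centre L9 (# 4)) (distinct L9 (# 4) (# 2)))

  open Model icosahedron-edges icosahedron-rows
  open FromCharts conn (p0 ∷ p1 ∷ p2 ∷ p3 ∷ p4 ∷ p5 ∷ p6 ∷ p7 ∷ p8 ∷ p9 ∷ p10 ∷ p11 ∷ [])
                     (L0 ∷ L1 ∷ L2 ∷ L3 ∷ L4 ∷ L5 ∷ L6 ∷ L7 ∷ L8 ∷ L9 ∷ L10 ∷ L11 ∷ [])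
                     (# 0) icosahedron-certificate
    public using (≅-model; index-φ)

icosahedron-recognition : {Γ : Graph} → (∀ u → Nbhd Γ u ≅ C 5) → Connected Γ →
                          ∀ {a b c} → Adj Γ a b → Adj Γ a c → Adj Γ b c →
                          Σ (Γ ≅ Icosahedron) λ ψ → to ψ a ≡ # 0 × to ψ b ≡ # 1 × to ψ c ≡ # 2
icosahedron-recognition L conn ab ac bc = ≅-model , index-φ (# 0) , index-φ (# 1) , index-φ (# 2)
  where open Icosahedron-Recognition L conn ab ac bc

C3-complete : ∀ i j → i ≢ j → Adj (C 3) i j
C3-complete = from-yes (all? λ i → all? λ j → ¬? (i ≟ j) →-dec T? (adj (C 3) i j))

locally-C3⇒no-2-geodesic : {Γ : Graph} → (∀ u → Nbhd Γ u ≅ C 3) → ¬ TwoGeodesic Γ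
locally-C3⇒no-2-geodesic {Γ} L (u , v , w , uv , vw , d) =
  dist-2⇒≁ d (rim⇒adj c (at-position c vu) (at-position c vw)
                 (C3-complete _ _ (position-≢ c vu vw (dist-2⇒≢ d))))
  where
  c : Chart Γ 3 v (link L v)
  c = link-chart L v
  vu : Adj Γ v u
  vu = adj-sym Γ uv

0-3-no-common-neighbour : ∀ r (j : Fin (6 + r)) → Adj (C (6 + r)) fz j → ¬ Adj (C (6 + r)) j (# 3)
0-3-no-common-neighbour r fz                            ()
0-3-no-common-neighbour r (fs fz)                       _  ()
0-3-no-common-neighbour r (fs (fs fz))                  ()
0-3-no-common-neighbour r (fs (fs (fs fz)))             _  ()
0-3-no-common-neighbour r (fs (fs (fs (fs fz))))        ()
-- The wrap-around test for the edge {5 + j, 3} is stuck on j, but fails either way.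
0-3-no-common-neighbour r (fs (fs (fs (fs (fs j)))))    _  j3 with toℕ j ≡ᵇ r
... | true  = j3
... | false = j3

module _ {Γ : Graph} {r : ℕ} (L : ∀ u → Nbhd Γ u ≅ C (6 + r)) (v : V Γ) where

  private
    c : Chart Γ (6 + r) v (link L v)
    c = link-chart L v

  geodesic-in-link : ∀ k → fz ≢ k → ¬ Adj (C (6 + r)) fz k → TwoGeodesic Γ
  geodesic-in-link k 0≢k 0≁k = link L v fz , v , link L v k , adj-sym Γ (centre c fz) , centre c k ,
    dist-2 (adj-sym Γ (centre c fz)) (centre c k)
           (λ e → 0≢k (injective c _ _ e)) (λ a → 0≁k (adj⇒rim c refl refl a))

  no-automorphism-sends-2-to-3 : (σ : Aut Γ) → act σ (link L v fz) ≡ link L v fz → act σ v ≡ v →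
                                 act σ (link L v (# 2)) ≢ link L v (# 3)
  no-automorphism-sends-2-to-3 σ σu≡u σv≡v σw₂≡w₃ =
    0-3-no-common-neighbour r (position c vσy)
      (adj⇒rim c refl (at-position c vσy) uσy) (adj⇒rim c (at-position c vσy) refl σyw₃)
    where
    σy : V Γ
    σy = act σ (link L v (# 1))
    vσy : Adj Γ v σy
    vσy = subst (λ x → Adj Γ x σy) σv≡v (to-adj σ (centre c (# 1)))
    uσy : Adj Γ (link L v fz) σy
    uσy = subst (λ x → Adj Γ x σy) σu≡u (to-adj σ (rim-adj c (# 0) (# 1)))
    σyw₃ : Adj Γ σy (link L v (# 3))
    σyw₃ = subst (Adj Γ σy) σw₂≡w₃ (to-adj σ (rim-adj c (# 1) (# 2)))

  locally-C≥6⇒¬2-geodesic-transitive : ¬ TwoGeodesicTransitive' Γ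
  locally-C≥6⇒¬2-geodesic-transitive transitive =
    let σ , σu≡u , σv≡v , σw₂≡w₃ =
          transitive (geodesic-in-link (# 2) (λ ()) (λ ())) (geodesic-in-link (# 3) (λ ()) (λ ()))
    in no-automorphism-sends-2-to-3 σ σu≡u σv≡v σw₂≡w₃

valency-invariant : ∀ {G H : Graph} {n m} → G ≅ H → (∀ u → Nbhd G u ≅ C n) → ∀ {h z} → Chart H m h z → n ≡ m
valency-invariant {G} {H} {n} {m} ψ L {h} {z} model =
  cantor-schröder-bernstein {f = f} {g = g} f-injective g-injective
  where
  u : V G
  u = from ψ h
  c : Chart G n u (link L u)
  c = link-chart L u
  h-adj : ∀ k → Adj H h (to ψ (link L u k))
  h-adj k = subst (λ x → Adj H x (to ψ (link L u k))) (to-from ψ h) (to-adj ψ (centre c k))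
  f : Fin n → Fin m
  f k = position model (h-adj k)
  f-injective : ∀ {k l} → f k ≡ f l → k ≡ l
  f-injective {k} {l} e = injective c k l (to-injective ψ
    (trans (sym (at-position model (h-adj k))) (trans (cong z e) (at-position model (h-adj l)))))
  u-adj : ∀ k → Adj G u (from ψ (z k))
  u-adj k = from-adj ψ (centre model k)
  g : Fin m → Fin n
  g k = position c (u-adj k)
  g-injective : ∀ {k l} → g k ≡ g l → k ≡ l
  g-injective {k} {l} e = injective model k l (from-injective ψ
    (trans (sym (at-position c (u-adj k))) (trans (cong (link L u) e) (at-position c (u-adj l)))))

module _ {n : ℕ} (S : ShortCycle n) {Γ H : Graph} (L : ∀ u → Nbhd Γ u ≅ C (2 + n)) {h₀ h₁ h₂ h₃ : V H}
         (standard : ∀ {a b c} → Adj Γ a b → Adj Γ a c → Adj Γ b c →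
                     Σ (Γ ≅ H) λ ψ → to ψ a ≡ h₀ × to ψ b ≡ h₁ × to ψ c ≡ h₂)
         (h₃-unique : ∀ t → Adj H h₀ t → Adj H h₂ t → t ≢ h₁ → t ≡ h₃) where
  open ShortCycle S

  arc-standard : (a : Arc Γ) → Σ (Γ ≅ H) λ ψ → to ψ (proj₁ a) ≡ h₀ × to ψ (proj₁ (proj₂ a)) ≡ h₁
  arc-standard (u , v , uv) = extend (has-neighbour (position c uv))
    where
    c : Chart Γ (2 + n) u (link L u)
    c = link-chart L u
    extend : ∃ (λ k → Adj (C (2 + n)) (position c uv) k) → Σ (Γ ≅ H) λ ψ → to ψ u ≡ h₀ × to ψ v ≡ h₁
    extend (k , ik) =
      let ψ , ψu , ψv , _ = standard uv (centre c k) (rim⇒adj c (at-position c uv) refl ik) in ψ , ψu , ψv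

  2-geodesic-standard : (g : TwoGeodesic Γ) → Σ (Γ ≅ H) λ ψ →
    to ψ (proj₁ g) ≡ h₁ × to ψ (proj₁ (proj₂ g)) ≡ h₀ × to ψ (proj₁ (proj₂ (proj₂ g))) ≡ h₃
  2-geodesic-standard (u , v , w , uv , vw , d) = extend (diameter-2 i j (position-≢ c vu vw (dist-2⇒≢ d)) i≁j)
    where
    c : Chart Γ (2 + n) v (link L v)
    c = link-chart L v
    vu : Adj Γ v u
    vu = adj-sym Γ uv
    i j : Fin (2 + n)
    i = position c vu
    j = position c vw
    i≁j : ¬ Adj (C (2 + n)) i j
    i≁j ij = dist-2⇒≁ d (rim⇒adj c (at-position c vu) (at-position c vw) ij)
    extend : ∃ (λ k → Adj (C (2 + n)) i k × Adj (C (2 + n)) k j) →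
             Σ (Γ ≅ H) λ ψ → to ψ u ≡ h₁ × to ψ v ≡ h₀ × to ψ w ≡ h₃
    extend (k , ik , kj) =
      let ψ , ψv , ψu , ψx = standard vu (centre c k) ux
      in ψ , ψu , ψv , h₃-unique (to ψ w) (subst (λ y → Adj H y (to ψ w)) ψv (to-adj ψ vw))
                                          (subst (λ y → Adj H y (to ψ w)) ψx (to-adj ψ xw))
                                          (λ e → dist-2⇒≢ d (to-injective ψ (trans ψu (sym e))))
      where
      ux : Adj Γ u (link L v k)
      ux = rim⇒adj c (at-position c vu) refl ik
      xw : Adj Γ (link L v k) w
      xw = rim⇒adj c refl (at-position c vw) kj

  standard-triangles⇒2-geodesic-transitive : TwoGeodesicTransitive Γ
  standard-triangles⇒2-geodesic-transitive = arc-transitive , 2-geodesic-transitive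
    where
    arc-transitive : ArcTransitive Γ
    arc-transitive a b =
      let ψ , ψu , ψv = arc-standard a ; χ , χu , χv = arc-standard b
      in ≅-trans ψ (≅-sym χ) ,
         act-≅-trans-≅-sym ψ χ (trans ψu (sym χu)) , act-≅-trans-≅-sym ψ χ (trans ψv (sym χv))
    2-geodesic-transitive : TwoGeodesicTransitive' Γ
    2-geodesic-transitive g g′ =
      let ψ , ψu , ψv , ψw = 2-geodesic-standard g ; χ , χu , χv , χw = 2-geodesic-standard g′
      in ≅-trans ψ (≅-sym χ) , act-≅-trans-≅-sym ψ χ (trans ψu (sym χu)) ,
         act-≅-trans-≅-sym ψ χ (trans ψv (sym χv)) , act-≅-trans-≅-sym ψ χ (trans ψw (sym χw))

K3[2]-fourth-vertex : ∀ t → Adj K3[2] (# 0) t → Adj K3[2] (# 4) t → t ≢ # 2 → t ≡ # 3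
K3[2]-fourth-vertex = from-yes (all? λ t →
  T? (adj K3[2] (# 0) t) →-dec T? (adj K3[2] (# 4) t) →-dec ¬? (t ≟ # 2) →-dec t ≟ # 3)

icosahedron-fourth-vertex : ∀ t → Adj Icosahedron (# 0) t → Adj Icosahedron (# 2) t → t ≢ # 1 → t ≡ # 3
icosahedron-fourth-vertex = from-yes (all? λ t →
  T? (adj Icosahedron (# 0) t) →-dec T? (adj Icosahedron (# 2) t) →-dec ¬? (t ≟ # 1) →-dec t ≟ # 3)

locally-C4⇒≅K3[2] : {Γ : Graph} → (∀ u → Nbhd Γ u ≅ C 4) → Connected Γ → V Γ → Γ ≅ K3[2]
locally-C4⇒≅K3[2] {Γ} L conn x =
  proj₁ (K3[2]-recognition L conn (centre c (# 0)) (centre c (# 1)) (rim-adj c (# 0) (# 1)))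
  where
  c : Chart Γ 4 x (link L x)
  c = link-chart L x

locally-C5⇒≅icosahedron : {Γ : Graph} → (∀ u → Nbhd Γ u ≅ C 5) → Connected Γ → V Γ → Γ ≅ Icosahedron
locally-C5⇒≅icosahedron {Γ} L conn x =
  proj₁ (icosahedron-recognition L conn (centre c (# 0)) (centre c (# 1)) (rim-adj c (# 0) (# 1)))
  where
  c : Chart Γ 5 x (link L x)
  c = link-chart L x

2-geodesic-transitive⇒K3[2]-or-icosahedron :
  {Γ : Graph} → DecidableEquality (V Γ) → Connected Γ → NonComplete Γ →
  ∀ {n} → 3 ≤ n → (∀ u → Nbhd Γ u ≅ C n) → TwoGeodesicTransitive' Γ → (Γ ≅ K3[2]) ⊎ (Γ ≅ Icosahedron)
2-geodesic-transitive⇒K3[2]-or-icosahedron _ _ _ {1} (s≤s ()) _ _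
2-geodesic-transitive⇒K3[2]-or-icosahedron _ _ _ {2} (s≤s (s≤s ())) _ _
2-geodesic-transitive⇒K3[2]-or-icosahedron _≟_ conn nc {3} _ L _ =
  ⊥-elim (locally-C3⇒no-2-geodesic L (2-geodesic-exists _≟_ conn nc))
2-geodesic-transitive⇒K3[2]-or-icosahedron _≟_ conn nc {4} _ L _ =
  inj₁ (locally-C4⇒≅K3[2] L conn (proj₁ nc))
2-geodesic-transitive⇒K3[2]-or-icosahedron _≟_ conn nc {5} _ L _ =
  inj₂ (locally-C5⇒≅icosahedron L conn (proj₁ nc))
2-geodesic-transitive⇒K3[2]-or-icosahedron _≟_ conn nc {suc (suc (suc (suc (suc (suc r)))))} _ L transitive =
  ⊥-elim (locally-C≥6⇒¬2-geodesic-transitive L (proj₁ nc) transitive)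

≅K3[2]⇒2-geodesic-transitive : {Γ : Graph} {n : ℕ} → Connected Γ → (∀ u → Nbhd Γ u ≅ C n) →
                               Γ ≅ K3[2] → TwoGeodesicTransitive Γ
≅K3[2]⇒2-geodesic-transitive {Γ} conn L ψ =
  standard-triangles⇒2-geodesic-transitive C4-short L₄ (K3[2]-recognition L₄ conn) K3[2]-fourth-vertex
  where
  L₄ : ∀ u → Nbhd Γ u ≅ C 4
  L₄ = subst (λ k → ∀ u → Nbhd Γ u ≅ C k) (valency-invariant ψ L (proj₁ K3[2]-certificate (# 0))) L

≅icosahedron⇒2-geodesic-transitive : {Γ : Graph} {n : ℕ} → Connected Γ → (∀ u → Nbhd Γ u ≅ C n) →
                                     Γ ≅ Icosahedron → TwoGeodesicTransitive Γ
≅icosahedron⇒2-geodesic-transitive {Γ} conn L ψ =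
  standard-triangles⇒2-geodesic-transitive C5-short L₅
    (icosahedron-recognition L₅ conn) icosahedron-fourth-vertex
  where
  L₅ : ∀ u → Nbhd Γ u ≅ C 5
  L₅ = subst (λ k → ∀ u → Nbhd Γ u ≅ C k) (valency-invariant ψ L (proj₁ icosahedron-certificate (# 0))) L

corollary1p2 : (Γ : Graph) → Finite Γ → Connected Γ → NonComplete Γ → LocallyCyclic Γ →
    TwoGeodesicTransitive Γ ⇔ ((Γ ≅ K3[2]) ⊎ (Γ ≅ Icosahedron))
corollary1p2 Γ fin conn nc (n , 3≤n , L) = mk⇔
  (λ (_ , transitive) → 2-geodesic-transitive⇒K3[2]-or-icosahedron (finite⇒≟ Γ fin) conn nc 3≤n L transitive)
  [ ≅K3[2]⇒2-geodesic-transitive conn L , ≅icosahedron⇒2-geodesic-transitive conn L ]
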